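{- Let $G=(V,E)$ be a simple directed graph, let $i\in\mathbb{N}$, and let $B_i=\{v\in V:\mathrm{InDeg}_G(v)>2^i\}$. If a set of vertices $S$ with $|S|\le 2^i$ induces a top SCC in $G$, or induces an almost top SCC in $G$ with respect to some vertex $v$, then $S\subseteq V\setminus B_i$.
   Context: A top SCC (tSCC) is a strongly connected component with no incoming edges from outside it. $S$ induces an almost tSCC with respect to $v$ in $G$ if $G[S]$ is a tSCC of $G\setminus\{v\}$ (the graph with vertex $v$ removed) but $S$ has an incoming edge from $v$ in $G$. $\mathrm{InDeg}_G(v)$ is the number of edges of $G$ entering $v$. -}

module Defs where

open import Data.Nat using (ℕ; _<_; _^_)
open import Data.Nat.Properties using (_<?_)
open import Data.Bool using (Bool; true; false)
open import Data.Fin using (Fin)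
open import Data.Fin.Subset using (Subset; _∈_; _∉_; _⊆_; ∁; ⁅_⁆; ∣_∣; Nonempty)
open import Data.Vec using (tabulate)
open import Data.Product using (_×_; ∃)
open import Relation.Binary.PropositionalEquality using (_≡_)
open import Relation.Nullary.Decidable using (does)

record Digraph : Set where
  field
    n       : ℕ
    adj     : Fin n → Fin n → Bool
    loopless : ∀ v → adj v v ≡ false
open Digraph public

InDeg : (G : Digraph) → Fin (n G) → ℕ
InDeg G v = ∣ tabulate (λ u → adj G u v) ∣

-- Reach G S u w : there is a directed path from u to w all of whose vertices lie in S
-- (i.e. a path in the induced subgraph G[S]).
data Reach (G : Digraph) (S : Subset (n G)) : Fin (n G) → Fin (n G) → Set where
  here : ∀ {u} → u ∈ S → Reach G S u u
  step : ∀ {u x w} → u ∈ S → adj G u x ≡ true → Reach G S x w → Reach G S u w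

StronglyConnected : (G : Digraph) → Subset (n G) → Set
StronglyConnected G S = ∀ u w → u ∈ S → w ∈ S → Reach G S u w

IsSCCIn : (G : Digraph) → Subset (n G) → Subset (n G) → Set
IsSCCIn G A S =
  S ⊆ A × Nonempty S × StronglyConnected G S ×
  (∀ T → S ⊆ T → T ⊆ A → StronglyConnected G T → T ⊆ S)

IsTopSCCIn : (G : Digraph) → Subset (n G) → Subset (n G) → Set
IsTopSCCIn G A S =
  IsSCCIn G A S × (∀ u w → u ∈ A → u ∉ S → w ∈ S → adj G u w ≡ false)

Vall : (G : Digraph) → Subset (n G)
Vall G = tabulate (λ _ → true)

IsTopSCC : (G : Digraph) → Subset (n G) → Set
IsTopSCC G S = IsTopSCCIn G (Vall G) S

IsAlmostTopSCC : (G : Digraph) → Fin (n G) → Subset (n G) → Set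
IsAlmostTopSCC G v S =
  IsTopSCCIn G (∁ ⁅ v ⁆) S × ∃ (λ w → w ∈ S × adj G v w ≡ true)

B : (G : Digraph) → ℕ → Subset (n G)
B G i = tabulate (λ v → does (2 ^ i <? InDeg G v))

-- Every in-neighbour of a vertex w of a top SCC S lies in S, and w is not its own
-- in-neighbour, so the in-neighbourhood of w is a proper subset of S and
-- InDeg(w) < |S| ≤ 2^i.  For an almost top SCC with respect to v the same argument
-- applies with S ∪ {v} in place of S, giving InDeg(w) < |S| + 1.
module Submission where

open import Defs
open import Data.Bool using (Bool; true; false)
open import Data.Bool.Properties using (T-≡)
open import Data.Fin using (Fin; _≟_)
open import Data.Fin.Subset using (Subset; _⊆_; ∁; ∣_∣; _∈_; _∉_; _∪_; ⁅_⁆)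
open import Data.Fin.Subset.Properties
  using (_∈?_; p⊂q⇒∣p∣<∣q∣; ∣p∣≤∣x∷p∣; ∣⁅x⁆∣≡1; x∈p∪q⁺; x∈⁅x⁆; x≢y⇒x∉⁅y⁆; x∉p⇒x∈∁p)
open import Data.Nat using (ℕ; _≤_; _<_; _+_; _^_; suc; z≤n; s≤s)
open import Data.Nat.Properties
  using (<ᵇ⇒<; ≤-trans; ≤-reflexive; +-monoʳ-≤; +-suc; +-comm; <⇒≤; <-≤-trans; <⇒≱; ≤-pred)
open import Data.Product using (∃; _,_)
open import Data.Sum using (_⊎_; inj₁; inj₂)
open import Data.Vec using ([]; _∷_; tabulate)
open import Data.Vec.Properties using (lookup∘tabulate; []=⇒lookup; lookup⇒[]=)
open import Function.Bundles using (Equivalence)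
open import Relation.Binary.PropositionalEquality using (_≡_; refl; sym; trans; cong)
open import Relation.Nullary using (yes; no)

∈-tabulate⁺ : ∀ {m} {f : Fin m → Bool} {x} → f x ≡ true → x ∈ tabulate f
∈-tabulate⁺ {f = f} {x} fx = lookup⇒[]= x (tabulate f) (trans (lookup∘tabulate f x) fx)

∈-tabulate⁻ : ∀ {m} {f : Fin m → Bool} {x} → x ∈ tabulate f → f x ≡ true
∈-tabulate⁻ {f = f} {x} x∈ = trans (sym (lookup∘tabulate f x)) ([]=⇒lookup x∈)

∣p∪q∣≤∣p∣+∣q∣ : ∀ {m} (p q : Subset m) → ∣ p ∪ q ∣ ≤ ∣ p ∣ + ∣ q ∣
∣p∪q∣≤∣p∣+∣q∣ [] [] = z≤n
∣p∪q∣≤∣p∣+∣q∣ (true ∷ p) (b ∷ q) =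
  s≤s (≤-trans (∣p∪q∣≤∣p∣+∣q∣ p q) (+-monoʳ-≤ ∣ p ∣ (∣p∣≤∣x∷p∣ b q)))
∣p∪q∣≤∣p∣+∣q∣ (false ∷ p) (true ∷ q) =
  ≤-trans (s≤s (∣p∪q∣≤∣p∣+∣q∣ p q)) (≤-reflexive (sym (+-suc ∣ p ∣ ∣ q ∣)))
∣p∪q∣≤∣p∣+∣q∣ (false ∷ p) (false ∷ q) = ∣p∪q∣≤∣p∣+∣q∣ p q

∣p∪⁅x⁆∣≤1+∣p∣ : ∀ {m} (p : Subset m) (x : Fin m) → ∣ p ∪ ⁅ x ⁆ ∣ ≤ suc ∣ p ∣
∣p∪⁅x⁆∣≤1+∣p∣ p x = ≤-trans (∣p∪q∣≤∣p∣+∣q∣ p ⁅ x ⁆)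
  (≤-reflexive (trans (cong (∣ p ∣ +_) (∣⁅x⁆∣≡1 x)) (+-comm ∣ p ∣ 1)))

inNeighbours : (G : Digraph) → Fin (n G) → Subset (n G)
inNeighbours G w = tabulate (λ u → adj G u w)

∉-inNeighbours-self : (G : Digraph) (w : Fin (n G)) → w ∉ inNeighbours G w
∉-inNeighbours-self G w w∈ with trans (sym (∈-tabulate⁻ w∈)) (loopless G w)
... | ()

InDeg<∣∣ : (G : Digraph) {w : Fin (n G)} {T : Subset (n G)} →
  inNeighbours G w ⊆ T → w ∈ T → InDeg G w < ∣ T ∣
InDeg<∣∣ G {w} N⊆T w∈T = p⊂q⇒∣p∣<∣q∣ (N⊆T , w , w∈T , ∉-inNeighbours-self G w)

topSCC-inNeighbour∈ : (G : Digraph) {A S : Subset (n G)} {u w : Fin (n G)} →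
  IsTopSCCIn G A S → w ∈ S → u ∈ A → u ∈ inNeighbours G w → u ∈ S
topSCC-inNeighbour∈ G {S = S} {u} {w} (_ , noEdgeIn) w∈S u∈A u∈N with u ∈? S
... | yes u∈S = u∈S
... | no u∉S with trans (sym (∈-tabulate⁻ u∈N)) (noEdgeIn u w u∈A u∉S w∈S)
... | ()

topSCC-InDeg≤ : (G : Digraph) {S : Subset (n G)} {w : Fin (n G)} →
  IsTopSCC G S → w ∈ S → InDeg G w ≤ ∣ S ∣
topSCC-InDeg≤ G top w∈S =
  <⇒≤ (InDeg<∣∣ G (topSCC-inNeighbour∈ G top w∈S (∈-tabulate⁺ refl)) w∈S)

almostTopSCC-InDeg≤ : (G : Digraph) {v : Fin (n G)} {S : Subset (n G)} {w : Fin (n G)} →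
  IsAlmostTopSCC G v S → w ∈ S → InDeg G w ≤ ∣ S ∣
almostTopSCC-InDeg≤ G {v} {S} {w} (top , _) w∈S =
  ≤-pred (<-≤-trans (InDeg<∣∣ G N⊆S∪v (x∈p∪q⁺ (inj₁ w∈S))) (∣p∪⁅x⁆∣≤1+∣p∣ S v))
  where
  N⊆S∪v : inNeighbours G w ⊆ S ∪ ⁅ v ⁆
  N⊆S∪v {u} u∈N with u ≟ v
  ... | yes refl = x∈p∪q⁺ (inj₂ (x∈⁅x⁆ u))
  ... | no u≢v = x∈p∪q⁺ (inj₁ (topSCC-inNeighbour∈ G top w∈S (x∉p⇒x∈∁p (x≢y⇒x∉⁅y⁆ u≢v)) u∈N))

InDeg≤⇒∈∁B : (G : Digraph) (i : ℕ) {w : Fin (n G)} → InDeg G w ≤ 2 ^ i → w ∈ ∁ (B G i)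
InDeg≤⇒∈∁B G i {w} InDeg≤ = x∉p⇒x∈∁p λ w∈B →
  <⇒≱ (<ᵇ⇒< (2 ^ i) (InDeg G w) (Equivalence.from T-≡ (∈-tabulate⁻ {x = w} w∈B)))
    InDeg≤

mainTheorem8 : (G : Digraph) (i : ℕ) (S : Subset (n G)) →
    ∣ S ∣ ≤ 2 ^ i →
    (IsTopSCC G S ⊎ ∃ (λ (v : Fin (n G)) → IsAlmostTopSCC G v S)) →
    S ⊆ ∁ (B G i)
mainTheorem8 G i S ∣S∣≤2^i (inj₁ top) w∈S =
  InDeg≤⇒∈∁B G i (≤-trans (topSCC-InDeg≤ G top w∈S) ∣S∣≤2^i)
mainTheorem8 G i S ∣S∣≤2^i (inj₂ (_ , almostTop)) w∈S =
  InDeg≤⇒∈∁B G i (≤-trans (almostTopSCC-InDeg≤ G almostTop w∈S) ∣S∣≤2^i)
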